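{- Let $\ell$ be a prime and $1\to C_\ell\to G\xrightarrow{\kappa}H\to1$ a central extension of finite groups (the kernel, cyclic of order $\ell$, lies in the center $Z(G)$). Let $\tilde G:=C_\ell\times G$. Then $\tilde G\cong G\times_H G$, and for $D:=\{(a,b)\in C_\ell\times G:\kappa(b)=1\}\cong C_\ell\times C_\ell$ we have: (i) $D\le Z(\tilde G)=C_\ell\times Z(G)$; (ii) $D$ has exactly $\ell+1$ subgroups $U_1,\ldots,U_{\ell+1}$ of order $\ell$, and all of them are normal in $\tilde G$; (iii) all quotients $\tilde G/U_i$ $(1\le i\le\ell+1)$ except one are isomorphic to $G$, and the remaining one is isomorphic to $C_\ell\times H$.
   Context: For epimorphisms $\kappa_i:G_i\to H$, the fiber product is $G_1\times_H G_2:=\{(g_1,g_2):\kappa_1(g_1)=\kappa_2(g_2)\}$ with componentwise multiplication; here both maps are $\kappa$. -}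

module Defs where

open import Level using (Level; _⊔_; 0ℓ)
open import Algebra.Bundles using (Group; RawGroup)
open import Algebra.Morphism.Structures using (module GroupMorphisms)
import Algebra.Construct.DirectProduct as DP
open import Data.Product using (Σ; ∃; _×_; _,_; proj₁; proj₂)
open import Data.Nat using (ℕ; zero; suc)
open import Data.Fin using (Fin)
open import Data.Unit.Polymorphic using (⊤)
open import Relation.Unary using (Pred)
open import Relation.Binary.PropositionalEquality using (_≡_)
import Relation.Binary.Reasoning.Setoid as SetoidReasoning

private
  variable
    a b c ℓ ℓ₁ ℓ₂ q : Level

_≅_ : RawGroup a ℓ₁ → RawGroup b ℓ₂ → Set (a ⊔ b ⊔ ℓ₁ ⊔ ℓ₂)
G₁ ≅ G₂ = ∃ λ f → GroupMorphisms.IsGroupIsomorphism G₁ G₂ f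

IsHom : (G : Group a ℓ₁) (H : Group b ℓ₂) → (Group.Carrier G → Group.Carrier H) → Set (a ⊔ ℓ₁ ⊔ ℓ₂)
IsHom G H f = GroupMorphisms.IsGroupHomomorphism (Group.rawGroup G) (Group.rawGroup H) f

_⊗_ : Group a ℓ₁ → Group b ℓ₂ → Group (a ⊔ b) (ℓ₁ ⊔ ℓ₂)
G ⊗ H = DP.group G H

module _ (G : Group c ℓ) where
  open Group G

  record IsSubgroup (P : Pred Carrier ℓ) : Set (c ⊔ ℓ) where
    field
      resp : ∀ {x y} → x ≈ y → P x → P y
      ε∈   : P ε
      ∙∈   : ∀ {x y} → P x → P y → P (x ∙ y)
      ⁻¹∈  : ∀ {x} → P x → P (x ⁻¹)

  record Subgroup : Set (Level.suc (c ⊔ ℓ)) where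
    constructor subgroup
    field
      mem        : Pred Carrier ℓ
      isSubgroup : IsSubgroup mem

  open Subgroup public

  _⊆_ : Pred Carrier q → Pred Carrier ℓ₂ → Set (c ⊔ q ⊔ ℓ₂)
  P ⊆ Q = ∀ x → P x → Q x

  _≐_ : Subgroup → Subgroup → Set (c ⊔ ℓ)
  U ≐ V = (mem U ⊆ mem V) × (mem V ⊆ mem U)

  IsNormal : Subgroup → Set (c ⊔ ℓ)
  IsNormal U = ∀ g x → mem U x → mem U ((g ∙ x) ∙ g ⁻¹)

  Central : Pred Carrier (c ⊔ ℓ)
  Central z = ∀ g → z ∙ g ≈ g ∙ z

  HasSize : Pred Carrier q → ℕ → Set (c ⊔ ℓ ⊔ q)
  HasSize P n = Σ (Fin n → Carrier) λ f →
      (∀ i → P (f i))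
    × (∀ i j → f i ≈ f j → i ≡ j)
    × (∀ x → P x → ∃ λ i → f i ≈ x)

  Order : ℕ → Set (c ⊔ ℓ)
  Order n = HasSize (λ _ → ⊤ {ℓ = 0ℓ}) n

  Finite : Set (c ⊔ ℓ)
  Finite = ∃ Order

  pow : Carrier → ℕ → Carrier
  pow g zero    = ε
  pow g (suc n) = g ∙ pow g n

  IsCyclic : Set (c ⊔ ℓ)
  IsCyclic = ∃ λ g → ∀ x → ∃ λ n → x ≈ pow g n

  subRaw : Subgroup → RawGroup (c ⊔ ℓ) ℓ
  subRaw U = record
    { Carrier = Σ Carrier (mem U)
    ; _≈_     = λ x y → proj₁ x ≈ proj₁ y
    ; _∙_     = λ x y → (proj₁ x ∙ proj₁ y) , IsSubgroup.∙∈ (isSubgroup U) (proj₂ x) (proj₂ y)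
    ; ε       = ε , IsSubgroup.ε∈ (isSubgroup U)
    ; _⁻¹     = λ x → (proj₁ x ⁻¹) , IsSubgroup.⁻¹∈ (isSubgroup U) (proj₂ x)
    }

  -- quotient G/U: same carrier and operations, x ≈ y iff x y⁻¹ ∈ U
  -- (a group when U is normal)
  quotRaw : Subgroup → RawGroup c ℓ
  quotRaw U = record
    { Carrier = Carrier
    ; _≈_     = λ x y → mem U (x ∙ y ⁻¹)
    ; _∙_     = _∙_
    ; ε       = ε
    ; _⁻¹     = _⁻¹
    }

module _ {G₁ G₂ H : Group c ℓ}
         (κ₁ : Group.Carrier G₁ → Group.Carrier H) (κ₂ : Group.Carrier G₂ → Group.Carrier H)
         (h₁ : IsHom G₁ H κ₁) (h₂ : IsHom G₂ H κ₂) where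
  private
    module H = Group H
    module h₁ = GroupMorphisms.IsGroupHomomorphism h₁
    module h₂ = GroupMorphisms.IsGroupHomomorphism h₂
    open SetoidReasoning H.setoid

  fiberSubgroup : Subgroup (G₁ ⊗ G₂)
  fiberSubgroup = subgroup (λ x → κ₁ (proj₁ x) H.≈ κ₂ (proj₂ x)) record
    { resp = λ { (e₁ , e₂) p → H.trans (H.sym (h₁.⟦⟧-cong e₁)) (H.trans p (h₂.⟦⟧-cong e₂)) }
    ; ε∈   = H.trans h₁.ε-homo (H.sym h₂.ε-homo)
    ; ∙∈   = λ {x} {y} p q → begin
               κ₁ (proj₁ x G₁∙ proj₁ y)          ≈⟨ h₁.homo _ _ ⟩
               κ₁ (proj₁ x) H.∙ κ₁ (proj₁ y)     ≈⟨ H.∙-cong p q ⟩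
               κ₂ (proj₂ x) H.∙ κ₂ (proj₂ y)     ≈⟨ H.sym (h₂.homo _ _) ⟩
               κ₂ (proj₂ x G₂∙ proj₂ y)          ∎
    ; ⁻¹∈  = λ p → H.trans (h₁.⁻¹-homo _) (H.trans (H.⁻¹-cong p) (H.sym (h₂.⁻¹-homo _)))
    }
    where
      open Group G₁ using () renaming (_∙_ to _G₁∙_)
      open Group G₂ using () renaming (_∙_ to _G₂∙_)

  FiberProduct : RawGroup (c ⊔ ℓ) ℓ
  FiberProduct = subRaw (G₁ ⊗ G₂) fiberSubgroup

module _ {C G H : Group c ℓ}
         (κ : Group.Carrier G → Group.Carrier H) (h : IsHom G H κ) where
  private
    module H = Group H
    module h = GroupMorphisms.IsGroupHomomorphism h

  DSubgroup : Subgroup (C ⊗ G)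
  DSubgroup = subgroup (λ x → κ (proj₂ x) H.≈ H.ε) record
    { resp = λ { (_ , e) p → H.trans (H.sym (h.⟦⟧-cong e)) p }
    ; ε∈   = h.ε-homo
    ; ∙∈   = λ p q → H.trans (h.homo _ _) (H.trans (H.∙-cong p q) (H.identityˡ _))
    ; ⁻¹∈  = λ p → H.trans (h.⁻¹-homo _) (H.trans (H.⁻¹-cong p) ε⁻¹≈ε)
    }
    where
      ε⁻¹≈ε : H.ε H.⁻¹ H.≈ H.ε
      ε⁻¹≈ε = H.trans (H.sym (H.identityʳ _)) (H.inverseˡ _)

{-# OPTIONS --safe #-}
-- Since ker κ = ι C is central, (a , b) ↦ (b , ι a ∙ b) embeds C × G homomorphically into G × G,
-- with image exactly the fibre product. D = C × ι C ≅ C × C is central in C × G, so all its subgroups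
-- are normal. As C is cyclic of prime order, each of its non-identity elements generates it; hence an
-- order-p subgroup of D is generated by any of its non-identity elements and is one of the p + 1 lines
-- {ε} × ι C, the kernel of (a , b) ↦ (a , κ b) with quotient C × H, or, for k < p, the graph
-- {(a , ι (a ^ k))}, the kernel of (a , b) ↦ b ∙ ι (a ^ k)⁻¹ with quotient G.
module Submission where

open import Defs
open import Level using (Level)
open import Algebra.Bundles using (Group; RawGroup; CommutativeMonoid)
open import Algebra.Morphism.Structures using (module GroupMorphisms)
import Algebra.Morphism.Construct.Composition as Composition
import Algebra.Properties.Group as GroupProperties
import Algebra.Properties.Monoid.Mult as MonoidMult
import Algebra.Properties.CommutativeMonoid.Mult as CommutativeMonoidMult
open import Data.Product using (Σ; ∃; _×_; _,_; proj₁; proj₂)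
open import Data.Product.Relation.Binary.Pointwise.NonDependent using (×-decidable)
open import Data.Nat using (ℕ; zero; suc; _+_; _*_; _∸_; _%_; _/_; _<_; _≤_; NonZero; s≤s)
import Data.Nat as ℕ
import Data.Nat.Properties as ℕ
open import Data.Nat.DivMod using (m≡m%n+[m/n]*n; m%n<n)
open import Data.Nat.Primality using (Prime; prime⇒nonTrivial)
open import Data.Nat.Coprimality using (prime⇒coprime; coprime-Bézout)
open import Data.Nat.GCD using (module Bézout)
open import Data.Fin using (Fin; zero; suc; toℕ; fromℕ<; punchOut)
import Data.Fin.Properties as Fin
open import Data.Unit.Polymorphic using (tt)
open import Data.Empty using (⊥-elim)
open import Function.Definitions using (Injective; Surjective)
open import Relation.Nullary using (¬_; yes; no)
open import Relation.Binary.Definitions using (Decidable; tri<; tri≈; tri>)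
open import Relation.Binary.PropositionalEquality as ≡ using (_≡_; _≢_)
open import Relation.Unary using (Pred)
import Relation.Binary.Reasoning.Setoid as SetoidReasoning

Fin-injective⇒surjective : ∀ {n} {f : Fin n → Fin n} → Injective _≡_ _≡_ f → ∀ j → ∃ λ i → f i ≡ j
Fin-injective⇒surjective {zero} _ ()
Fin-injective⇒surjective {suc n} {f} f-injective j with Fin.any? (λ i → f i Fin.≟ j)
... | yes hit = hit
... | no miss = ⊥-elim (ℕ.<-irrefl ≡.refl (Fin.injective⇒≤ g-injective))
  where
  j≢f : ∀ i → j ≢ f i
  j≢f i j≡fi = miss (i , ≡.sym j≡fi)
  g : Fin (suc n) → Fin n
  g i = punchOut (j≢f i)
  g-injective : Injective _≡_ _≡_ g
  g-injective {i} {k} e = f-injective (Fin.punchOut-injective (j≢f i) (j≢f k) e)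

module GroupLemmas {a ℓ} (G : Group a ℓ) where
  open Group G
  open GroupProperties G public
  open MonoidMult monoid using (×-congʳ; ×-homo-+; ×-assocˡ) renaming (_×_ to _×ⁿ_)
  open SetoidReasoning setoid

  -- pow is the library's monoid multiple _×_, so the laws proved for _×_ transfer.
  pow≡× : ∀ x n → pow G x n ≡ n ×ⁿ x
  pow≡× x zero    = ≡.refl
  pow≡× x (suc n) = ≡.cong (x ∙_) (pow≡× x n)

  pow-cong : ∀ n {x y} → x ≈ y → pow G x n ≈ pow G y n
  pow-cong n {x} {y} rewrite pow≡× x n | pow≡× y n = ×-congʳ n

  pow-+ : ∀ x m n → pow G x (m + n) ≈ pow G x m ∙ pow G x n
  pow-+ x m n rewrite pow≡× x (m + n) | pow≡× x m | pow≡× x n = ×-homo-+ x m n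

  pow-* : ∀ x m n → pow G x (m * n) ≈ pow G (pow G x n) m
  pow-* x m n rewrite pow≡× x (m * n) | pow≡× x n | pow≡× (n ×ⁿ x) m = sym (×-assocˡ x m n)

  pow-ε : ∀ n → pow G ε n ≈ ε
  pow-ε zero    = refl
  pow-ε (suc n) = trans (identityˡ _) (pow-ε n)

  pow-multiple-ε : ∀ x m → pow G x m ≈ ε → ∀ k → pow G x (k * m) ≈ ε
  pow-multiple-ε x m xᵐ≈ε k = begin
    pow G x (k * m)      ≈⟨ pow-* x k m ⟩
    pow G (pow G x m) k  ≈⟨ pow-cong k xᵐ≈ε ⟩
    pow G ε k            ≈⟨ pow-ε k ⟩
    ε                    ∎

  pow-mod : ∀ x d .{{_ : NonZero d}} → pow G x d ≈ ε → ∀ n → pow G x n ≈ pow G x (n % d)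
  pow-mod x d xᵈ≈ε n = begin
    pow G x n                                  ≡⟨ ≡.cong (pow G x) (m≡m%n+[m/n]*n n d) ⟩
    pow G x (n % d + (n / d) * d)              ≈⟨ pow-+ x (n % d) ((n / d) * d) ⟩
    pow G x (n % d) ∙ pow G x ((n / d) * d)    ≈⟨ ∙-congˡ (pow-multiple-ε x d xᵈ≈ε (n / d)) ⟩
    pow G x (n % d) ∙ ε                        ≈⟨ identityʳ _ ⟩
    pow G x (n % d)                            ∎

  pow-∸ : ∀ x {m n} → m ≤ n → pow G x m ≈ pow G x n → pow G x (n ∸ m) ≈ ε
  pow-∸ x {m} {n} m≤n xᵐ≈xⁿ = identityʳ-unique (pow G x m) _ (begin
    pow G x m ∙ pow G x (n ∸ m)  ≈⟨ pow-+ x m (n ∸ m) ⟨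
    pow G x (m + (n ∸ m))        ≡⟨ ≡.cong (pow G x) (ℕ.m+[n∸m]≡n m≤n) ⟩
    pow G x n                    ≈⟨ xᵐ≈xⁿ ⟨
    pow G x m                    ∎)

  pow-suc-ε⇒ε : ∀ x s → pow G x s ≈ ε → pow G x (suc s) ≈ ε → x ≈ ε
  pow-suc-ε⇒ε x s xˢ≈ε xˢ⁺¹≈ε = begin
    x              ≈⟨ identityʳ x ⟨
    x ∙ ε          ≈⟨ ∙-congˡ xˢ≈ε ⟨
    x ∙ pow G x s  ≈⟨ xˢ⁺¹≈ε ⟩
    ε              ∎

  -- A Bézout identity 1 + j e = i p (or 1 + i p = j e) gives x ∙ x^(j e) ≈ x^(i p), i.e. x ∙ ε ≈ ε.
  pow-prime-ε⇒ε : ∀ {p} → Prime p → ∀ x → pow G x p ≈ ε →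
                  ∀ {e} → 0 < e → e < p → pow G x e ≈ ε → x ≈ ε
  pow-prime-ε⇒ε {p} p-prime x xᵖ≈ε {e} 0<e e<p xᵉ≈ε
    with coprime-Bézout (prime⇒coprime p-prime {{ℕ.>-nonZero 0<e}} e<p)
  ... | Bézout.+- i j eq = pow-suc-ε⇒ε x (j * e) (pow-multiple-ε x e xᵉ≈ε j)
          (≡.subst (λ t → pow G x t ≈ ε) (≡.sym eq) (pow-multiple-ε x p xᵖ≈ε i))
  ... | Bézout.-+ i j eq = pow-suc-ε⇒ε x (i * p) (pow-multiple-ε x p xᵖ≈ε i)
          (≡.subst (λ t → pow G x t ≈ ε) (≡.sym eq) (pow-multiple-ε x e xᵉ≈ε j))

  pow-prime-collision⇒ε : ∀ {p} → Prime p → ∀ x → pow G x p ≈ ε →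
                          ∀ {i j} → i < j → j < p → pow G x i ≈ pow G x j → x ≈ ε
  pow-prime-collision⇒ε p-prime x xᵖ≈ε {i} {j} i<j j<p xⁱ≈xʲ =
    pow-prime-ε⇒ε p-prime x xᵖ≈ε (ℕ.m<n⇒0<n∸m i<j) (ℕ.≤-<-trans (ℕ.m∸n≤m j i) j<p)
                  (pow-∸ x (ℕ.<⇒≤ i<j) xⁱ≈xʲ)

  pow-prime-injective : ∀ {p} → Prime p → ∀ x → pow G x p ≈ ε → ¬ x ≈ ε →
                        ∀ (i j : Fin p) → pow G x (toℕ i) ≈ pow G x (toℕ j) → i ≡ j
  pow-prime-injective p-prime x xᵖ≈ε x≉ε i j xⁱ≈xʲ with ℕ.<-cmp (toℕ i) (toℕ j)
  ... | tri≈ _ i≡j _ = Fin.toℕ-injective i≡j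
  ... | tri< i<j _ _ = ⊥-elim (x≉ε (pow-prime-collision⇒ε p-prime x xᵖ≈ε i<j (Fin.toℕ<n j) xⁱ≈xʲ))
  ... | tri> _ _ j<i = ⊥-elim (x≉ε (pow-prime-collision⇒ε p-prime x xᵖ≈ε j<i (Fin.toℕ<n i) (sym xⁱ≈xʲ)))

  pow-∈ : (U : Subgroup G) → ∀ {x} → mem U x → ∀ n → mem U (pow G x n)
  pow-∈ U x∈U zero    = IsSubgroup.ε∈ (isSubgroup U)
  pow-∈ U x∈U (suc n) = IsSubgroup.∙∈ (isSubgroup U) x∈U (pow-∈ U x∈U n)

  central-resp : ∀ {x y} → x ≈ y → Central G x → Central G y
  central-resp x≈y x-central g = trans (∙-congʳ (sym x≈y)) (trans (x-central g) (∙-congˡ x≈y))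

  ∙-interchange : ∀ x y z w → y ∙ z ≈ z ∙ y → (x ∙ y) ∙ (z ∙ w) ≈ (x ∙ z) ∙ (y ∙ w)
  ∙-interchange x y z w yz≈zy = begin
    (x ∙ y) ∙ (z ∙ w)  ≈⟨ assoc x y (z ∙ w) ⟩
    x ∙ (y ∙ (z ∙ w))  ≈⟨ ∙-congˡ (assoc y z w) ⟨
    x ∙ ((y ∙ z) ∙ w)  ≈⟨ ∙-congˡ (∙-congʳ yz≈zy) ⟩
    x ∙ ((z ∙ y) ∙ w)  ≈⟨ ∙-congˡ (assoc z y w) ⟩
    x ∙ (z ∙ (y ∙ w))  ≈⟨ assoc x z (y ∙ w) ⟨
    (x ∙ z) ∙ (y ∙ w)  ∎

  central⇒normal : (U : Subgroup G) → _⊆_ G (mem U) (Central G) → IsNormal G U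
  central⇒normal U U⊆Z g x x∈U = IsSubgroup.resp (isSubgroup U) (sym gxg⁻¹≈x) x∈U
    where
    gxg⁻¹≈x : (g ∙ x) ∙ g ⁻¹ ≈ x
    gxg⁻¹≈x = begin
      (g ∙ x) ∙ g ⁻¹  ≈⟨ ∙-congʳ (U⊆Z x x∈U g) ⟨
      (x ∙ g) ∙ g ⁻¹  ≈⟨ assoc x g (g ⁻¹) ⟩
      x ∙ (g ∙ g ⁻¹)  ≈⟨ ∙-congˡ (inverseʳ g) ⟩
      x ∙ ε           ≈⟨ identityʳ x ⟩
      x               ∎

  Order⇒decidable : ∀ {n} → Order G n → Decidable _≈_
  Order⇒decidable (f , _ , f-injective , f-onto) x y with f-onto x tt | f-onto y tt
  ... | i , fi≈x | j , fj≈y with i Fin.≟ j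
  ...   | yes ≡.refl = yes (trans (sym fi≈x) fj≈y)
  ...   | no i≢j     = no (λ x≈y → i≢j (f-injective i j (trans fi≈x (trans x≈y (sym fj≈y)))))

  nontrivial-element : ∀ {q n} {P : Pred Carrier q} → Decidable _≈_ → 1 < n → HasSize G P n →
                       ∃ λ x → P x × ¬ x ≈ ε
  nontrivial-element _≟_ (s≤s (s≤s _)) (f , f∈P , f-injective , _) with f zero ≟ ε
  ... | no f₀≉ε  = f zero , f∈P zero , f₀≉ε
  ... | yes f₀≈ε = f (suc zero) , f∈P (suc zero) ,
                   λ f₁≈ε → Fin.0≢1+n (f-injective zero (suc zero) (trans f₀≈ε (sym f₁≈ε)))

  -- Sending each element of A to its index in B injects Fin n into itself, which is then onto.
  HasSize-⊆⇒⊇ : ∀ {q₁ q₂ n} {A : Pred Carrier q₁} {B : Pred Carrier q₂} →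
                (∀ {x y} → x ≈ y → A x → A y) → _⊆_ G A B →
                HasSize G A n → HasSize G B n → _⊆_ G B A
  HasSize-⊆⇒⊇ {n = n} A-resp A⊆B (f , f∈A , f-injective , _) (g , _ , _ , g-onto) y y∈B = A-resp fi≈y (f∈A i)
    where
    σ : Fin n → Fin n
    σ i = proj₁ (g-onto (f i) (A⊆B _ (f∈A i)))
    σ-spec : ∀ i → g (σ i) ≈ f i
    σ-spec i = proj₂ (g-onto (f i) (A⊆B _ (f∈A i)))
    σ-injective : Injective _≡_ _≡_ σ
    σ-injective {i} {i′} σi≡σi′ =
      f-injective i i′ (trans (sym (σ-spec i)) (trans (reflexive (≡.cong g σi≡σi′)) (σ-spec i′)))
    j : Fin n
    j = proj₁ (g-onto y y∈B)
    i : Fin n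
    i = proj₁ (Fin-injective⇒surjective σ-injective j)
    fi≈y : f i ≈ y
    fi≈y = begin
      f i      ≈⟨ σ-spec i ⟨
      g (σ i)  ≡⟨ ≡.cong g (proj₂ (Fin-injective⇒surjective σ-injective j)) ⟩
      g j      ≈⟨ proj₂ (g-onto y y∈B) ⟩
      y        ∎

  pow-period : ∀ {n} → Order G n → ∀ x → ∃ λ d → 0 < d × d ≤ n × pow G x d ≈ ε
  pow-period {n} (f , _ , _ , f-onto) x
    with i , j , i<j , same-index ← Fin.pigeonhole (ℕ.n<1+n n) (λ k → proj₁ (f-onto (pow G x (toℕ k)) tt))
    = toℕ j ∸ toℕ i , ℕ.m<n⇒0<n∸m i<j , ℕ.≤-trans (ℕ.m∸n≤m (toℕ j) (toℕ i)) (Fin.toℕ≤pred[n] j) ,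
      pow-∸ x (ℕ.<⇒≤ i<j) (begin
        pow G x (toℕ i)                             ≈⟨ proj₂ (f-onto _ tt) ⟨
        f (proj₁ (f-onto (pow G x (toℕ i)) tt))     ≡⟨ ≡.cong f same-index ⟩
        f (proj₁ (f-onto (pow G x (toℕ j)) tt))     ≈⟨ proj₂ (f-onto _ tt) ⟩
        pow G x (toℕ j)                             ∎)

  powers-cover : ∀ {n} → Order G n → ∀ x → (∀ (i j : Fin n) → pow G x (toℕ i) ≈ pow G x (toℕ j) → i ≡ j) →
                 ∀ y → ∃ λ m → y ≈ pow G x m
  powers-cover {n} order x powers-injective y = toℕ (proj₁ y-power) , sym (proj₂ y-power)
    where
    Powers : Pred Carrier ℓ
    Powers y = ∃ λ (i : Fin n) → pow G x (toℕ i) ≈ y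
    Powers-resp : ∀ {y z} → y ≈ z → Powers y → Powers z
    Powers-resp y≈z (i , xⁱ≈y) = i , trans xⁱ≈y y≈z
    powers-size : HasSize G Powers n
    powers-size = (λ i → pow G x (toℕ i)) , (λ i → i , refl) , powers-injective , λ _ xⁱ≈y → xⁱ≈y
    y-power : Powers y
    y-power = HasSize-⊆⇒⊇ Powers-resp (λ _ _ → tt) powers-size order y tt

  ≐-by-powers : ∀ {n} (U V : Subgroup G) → HasSize G (mem U) n → HasSize G (mem V) n →
                ∀ {v} → mem V v → (∀ u → mem U u → ∃ λ m → pow G v m ≈ u) → _≐_ G V U
  ≐-by-powers U V U-size V-size v∈V U⊆powers =
    HasSize-⊆⇒⊇ (IsSubgroup.resp (isSubgroup U)) U⊆V U-size V-size , U⊆V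
    where
    U⊆V : _⊆_ G (mem U) (mem V)
    U⊆V u u∈U with m , vᵐ≈u ← U⊆powers u u∈U = IsSubgroup.resp (isSubgroup V) vᵐ≈u (pow-∈ V v∈V m)

module _ {a b ℓ₁ ℓ₂} (A : Group a ℓ₁) (B : Group b ℓ₂) where
  private
    module A = Group A
    module B = Group B
  open GroupMorphisms.IsGroupHomomorphism using (ε-homo; homo)

  pow-⊗ : ∀ x y n → Group._≈_ (A ⊗ B) (pow (A ⊗ B) (x , y) n) (pow A x n , pow B y n)
  pow-⊗ x y zero    = A.refl , B.refl
  pow-⊗ x y (suc n) = A.∙-congˡ (proj₁ (pow-⊗ x y n)) , B.∙-congˡ (proj₂ (pow-⊗ x y n))

  hom-pow : ∀ {f} → IsHom A B f → ∀ x n → f (pow A x n) B.≈ pow B (f x) n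
  hom-pow f-hom x zero    = ε-homo f-hom
  hom-pow f-hom x (suc n) = B.trans (homo f-hom x _) (B.∙-congˡ (hom-pow f-hom x n))

module _ {a b ℓ₁ ℓ₂} {A : RawGroup a ℓ₁} {B : RawGroup b ℓ₂} where
  private
    module A = RawGroup A
    module B = RawGroup B
  open GroupMorphisms A B

  mkIsGroupHomomorphism : ∀ f → (∀ {x y} → x A.≈ y → f x B.≈ f y) →
                          (∀ x y → f (x A.∙ y) B.≈ f x B.∙ f y) → f A.ε B.≈ B.ε →
                          (∀ x → f (x A.⁻¹) B.≈ f x B.⁻¹) → IsGroupHomomorphism f
  mkIsGroupHomomorphism f f-cong f-homo f-ε f-⁻¹ = record
    { isMonoidHomomorphism = record
      { isMagmaHomomorphism = record
        { isRelHomomorphism = record { cong = f-cong }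
        ; homo              = f-homo
        }
      ; ε-homo = f-ε
      }
    ; ⁻¹-homo = f-⁻¹
    }

  mkIso : ∀ {f} → IsGroupHomomorphism f → Injective A._≈_ B._≈_ f → Surjective A._≈_ B._≈_ f → A ≅ B
  mkIso f-hom f-injective f-onto = _ , record
    { isGroupMonomorphism = record { isGroupHomomorphism = f-hom ; injective = f-injective }
    ; surjective          = f-onto
    }

module _ {a b ℓ₁ ℓ₂} (A : Group a ℓ₁) (B : Group b ℓ₂) where
  private
    module A = Group A
    module B = Group B
    module B′ = GroupLemmas B

  isHom : ∀ f → (∀ {x y} → x A.≈ y → f x B.≈ f y) → (∀ x y → f (x A.∙ y) B.≈ f x B.∙ f y) → IsHom A B f
  isHom f f-cong f-homo = mkIsGroupHomomorphism f f-cong f-homo f-ε f-⁻¹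
    where
    f-ε : f A.ε B.≈ B.ε
    f-ε = B′.identityʳ-unique (f A.ε) (f A.ε) (B.trans (B.sym (f-homo A.ε A.ε)) (f-cong (A.identityˡ A.ε)))
    f-⁻¹ : ∀ x → f (x A.⁻¹) B.≈ f x B.⁻¹
    f-⁻¹ x = B′.inverseʳ-unique (f x) (f (x A.⁻¹))
               (B.trans (B.sym (f-homo x (x A.⁻¹))) (B.trans (f-cong (A.inverseʳ x)) f-ε))

module Kernel {a b ℓ} {A : Group a ℓ} {K : Group b ℓ}
              (φ : Group.Carrier A → Group.Carrier K) (φ-hom : IsHom A K φ) where
  private
    module A = Group A
    module K = Group K
    module K′ = GroupLemmas K
  open GroupMorphisms.IsGroupHomomorphism φ-hom

  kernel : Subgroup A
  kernel = subgroup (λ x → φ x K.≈ K.ε) record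
    { resp = λ x≈y φx≈ε → K.trans (K.sym (⟦⟧-cong x≈y)) φx≈ε
    ; ε∈   = ε-homo
    ; ∙∈   = λ φx≈ε φy≈ε → K.trans (homo _ _) (K.trans (K.∙-cong φx≈ε φy≈ε) (K.identityˡ K.ε))
    ; ⁻¹∈  = λ φx≈ε → K.trans (⁻¹-homo _) (K.trans (K.⁻¹-cong φx≈ε) K′.ε⁻¹≈ε)
    }

  φ-div : ∀ x y → φ (x A.∙ y A.⁻¹) K.≈ φ x K.∙ φ y K.⁻¹
  φ-div x y = K.trans (homo x (y A.⁻¹)) (K.∙-congˡ (⁻¹-homo y))

  ∈kernel⇒≈ : ∀ {x y} → mem kernel (x A.∙ y A.⁻¹) → φ x K.≈ φ y
  ∈kernel⇒≈ {x} {y} e = K′.x∙y⁻¹≈ε⇒x≈y (φ x) (φ y) (K.trans (K.sym (φ-div x y)) e)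

  ≈⇒∈kernel : ∀ {x y} → φ x K.≈ φ y → mem kernel (x A.∙ y A.⁻¹)
  ≈⇒∈kernel {x} {y} e = K.trans (φ-div x y) (K′.x≈y⇒x∙y⁻¹≈ε e)

  quotient-kernel≅ : (∀ y → ∃ λ x → φ x K.≈ y) → quotRaw A kernel ≅ Group.rawGroup K
  quotient-kernel≅ φ-onto =
    mkIso (mkIsGroupHomomorphism φ ∈kernel⇒≈ homo ε-homo ⁻¹-homo) ≈⇒∈kernel onto
    where
    onto : Surjective (RawGroup._≈_ (quotRaw A kernel)) K._≈_ φ
    onto y = proj₁ (φ-onto y) , λ z≈x → K.trans (∈kernel⇒≈ z≈x) (proj₂ (φ-onto y))

module _ {a b ℓ₁ ℓ₂} {A : Group a ℓ₁} {B : Group b ℓ₂} {f : Group.Carrier A → Group.Carrier B}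
         (f-hom : IsHom A B f) (f-injective : Injective (Group._≈_ A) (Group._≈_ B) f) where
  private
    module A = Group A
    module B = Group B
  open GroupMorphisms.IsGroupHomomorphism f-hom

  ≅-image : (S : Subgroup B) → (∀ x → mem S (f x)) → (∀ y → mem S y → ∃ λ x → f x B.≈ y) →
            Group.rawGroup A ≅ subRaw B S
  ≅-image S f∈S S⊆im = mkIso (mkIsGroupHomomorphism (λ x → f x , f∈S x) ⟦⟧-cong homo ε-homo ⁻¹-homo)
                             f-injective onto
    where
    onto : Surjective A._≈_ (RawGroup._≈_ (subRaw B S)) (λ x → f x , f∈S x)
    onto (y , y∈S) = proj₁ (S⊆im y y∈S) , λ z≈x → B.trans (⟦⟧-cong z≈x) (proj₂ (S⊆im y y∈S))

  ≅-preimage : (S : Subgroup B) → (∀ x → mem S (f x)) →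
               (r : ∀ y → mem S y → A.Carrier) → (∀ y y∈S → f (r y y∈S) B.≈ y) →
               subRaw B S ≅ Group.rawGroup A
  ≅-preimage S f∈S r f∘r≈id = mkIso (mkIsGroupHomomorphism r′ r-cong r-homo r-ε r-⁻¹) r-injective onto
    where
    open SetoidReasoning B.setoid
    r′ : Σ B.Carrier (mem S) → A.Carrier
    r′ (y , y∈S) = r y y∈S
    f∘r′≈proj₁ : ∀ y → f (r′ y) B.≈ proj₁ y
    f∘r′≈proj₁ (y , y∈S) = f∘r≈id y y∈S
    r-cong : ∀ {x y} → proj₁ x B.≈ proj₁ y → r′ x A.≈ r′ y
    r-cong {x} {y} x≈y = f-injective (B.trans (f∘r′≈proj₁ x) (B.trans x≈y (B.sym (f∘r′≈proj₁ y))))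
    r-homo : ∀ x y → r′ (RawGroup._∙_ (subRaw B S) x y) A.≈ r′ x A.∙ r′ y
    r-homo x y = f-injective (begin
      f (r′ (RawGroup._∙_ (subRaw B S) x y))  ≈⟨ f∘r′≈proj₁ _ ⟩
      proj₁ x B.∙ proj₁ y                     ≈⟨ B.∙-cong (f∘r′≈proj₁ x) (f∘r′≈proj₁ y) ⟨
      f (r′ x) B.∙ f (r′ y)                   ≈⟨ homo (r′ x) (r′ y) ⟨
      f (r′ x A.∙ r′ y)                       ∎)
    r-ε : r′ (RawGroup.ε (subRaw B S)) A.≈ A.ε
    r-ε = f-injective (B.trans (f∘r′≈proj₁ _) (B.sym ε-homo))
    r-⁻¹ : ∀ x → r′ (RawGroup._⁻¹ (subRaw B S) x) A.≈ r′ x A.⁻¹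
    r-⁻¹ x = f-injective (begin
      f (r′ (RawGroup._⁻¹ (subRaw B S) x))  ≈⟨ f∘r′≈proj₁ _ ⟩
      proj₁ x B.⁻¹                          ≈⟨ B.⁻¹-cong (f∘r′≈proj₁ x) ⟨
      f (r′ x) B.⁻¹                         ≈⟨ ⁻¹-homo (r′ x) ⟨
      f (r′ x A.⁻¹)                         ∎)
    r-injective : ∀ {x y} → r′ x A.≈ r′ y → proj₁ x B.≈ proj₁ y
    r-injective {x} {y} rx≈ry = begin
      proj₁ x   ≈⟨ f∘r′≈proj₁ x ⟨
      f (r′ x)  ≈⟨ ⟦⟧-cong rx≈ry ⟩
      f (r′ y)  ≈⟨ f∘r′≈proj₁ y ⟩
      proj₁ y   ∎
    onto : Surjective (RawGroup._≈_ (subRaw B S)) A._≈_ r′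
    onto x = (f x , f∈S x) , λ {z} z≈fx → f-injective (B.trans (f∘r′≈proj₁ z) z≈fx)

module Graph {c ℓ} {C G : Group c ℓ} (θ : Group.Carrier C → Group.Carrier G) (θ-hom : IsHom C G θ)
             (θ-central : ∀ a → Central G (θ a)) where
  private
    module C = Group C
    module C′ = GroupLemmas C
    open Group G
    open GroupLemmas G
    open SetoidReasoning setoid
  open GroupMorphisms.IsGroupHomomorphism θ-hom

  graph-defect : Group.Carrier (C ⊗ G) → Carrier
  graph-defect (a , b) = b ∙ θ (a C.⁻¹)

  -- A homomorphism since θ has central image; its kernel is the graph of θ.
  graph-defect-hom : IsHom (C ⊗ G) G graph-defect
  graph-defect-hom = isHom (C ⊗ G) G graph-defect
    (λ (a≈a′ , b≈b′) → ∙-cong b≈b′ (⟦⟧-cong (C.⁻¹-cong a≈a′))) graph-defect-homo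
    where
    graph-defect-homo : ∀ x y → graph-defect (Group._∙_ (C ⊗ G) x y) ≈ graph-defect x ∙ graph-defect y
    graph-defect-homo (a , b) (a′ , b′) = begin
      (b ∙ b′) ∙ θ ((a C.∙ a′) C.⁻¹)         ≈⟨ ∙-congˡ (⟦⟧-cong (C′.⁻¹-anti-homo-∙ a a′)) ⟩
      (b ∙ b′) ∙ θ (a′ C.⁻¹ C.∙ a C.⁻¹)      ≈⟨ ∙-congˡ (homo (a′ C.⁻¹) (a C.⁻¹)) ⟩
      (b ∙ b′) ∙ (θ (a′ C.⁻¹) ∙ θ (a C.⁻¹))  ≈⟨ ∙-congˡ (θ-central (a′ C.⁻¹) (θ (a C.⁻¹))) ⟩
      (b ∙ b′) ∙ (θ (a C.⁻¹) ∙ θ (a′ C.⁻¹))  ≈⟨ ∙-interchange b b′ (θ (a C.⁻¹)) (θ (a′ C.⁻¹))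
                                                  (sym (θ-central (a C.⁻¹) b′)) ⟩
      (b ∙ θ (a C.⁻¹)) ∙ (b′ ∙ θ (a′ C.⁻¹))  ∎

  graph-defect-onto : ∀ b → ∃ λ x → graph-defect x ≈ b
  graph-defect-onto b = (C.ε , b) , trans (∙-congˡ (trans (⟦⟧-cong C′.ε⁻¹≈ε) ε-homo)) (identityʳ b)

  graph : Subgroup (C ⊗ G)
  graph = Kernel.kernel {A = C ⊗ G} {K = G} graph-defect graph-defect-hom

  ∈graph⇒ : ∀ {a b} → mem graph (a , b) → b ≈ θ a
  ∈graph⇒ {a} {b} e = x∙y⁻¹≈ε⇒x≈y b (θ a) (trans (∙-congˡ (sym (⁻¹-homo a))) e)

  ∈graph⇐ : ∀ {a b} → b ≈ θ a → mem graph (a , b)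
  ∈graph⇐ {a} {b} b≈θa = trans (∙-congˡ (⁻¹-homo a)) (x≈y⇒x∙y⁻¹≈ε b≈θa)

  graph-size : ∀ {n} → Order C n → HasSize (C ⊗ G) (mem graph) n
  graph-size (f , _ , f-injective , f-onto) =
    (λ i → f i , θ (f i)) , (λ i → ∈graph⇐ refl) , (λ i j fi≈fj → f-injective i j (proj₁ fi≈fj)) ,
    λ (a , b) ab∈graph → proj₁ (f-onto a tt) , proj₂ (f-onto a tt) ,
                         trans (⟦⟧-cong (proj₂ (f-onto a tt))) (sym (∈graph⇒ ab∈graph))

  quotient-graph≅ : quotRaw (C ⊗ G) graph ≅ Group.rawGroup G
  quotient-graph≅ = Kernel.quotient-kernel≅ {A = C ⊗ G} {K = G} graph-defect graph-defect-hom graph-defect-onto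

module CyclicOfPrimeOrder {c ℓ p} (C : Group c ℓ) (p-prime : Prime p) (order : Order C p) (cyclic : IsCyclic C) where
  open Group C
  open GroupLemmas C
  open SetoidReasoning setoid

  private
    instance
      p-nonTrivial : ℕ.NonTrivial p
      p-nonTrivial = prime⇒nonTrivial p-prime
      p-nonZero : NonZero p
      p-nonZero = ℕ.nonTrivial⇒nonZero p
    g : Carrier
    g = proj₁ cyclic
    log : Carrier → ℕ
    log x = proj₁ (proj₂ cyclic x)
    log-spec : ∀ x → x ≈ pow C g (log x)
    log-spec x = proj₂ (proj₂ cyclic x)

  comm : ∀ x y → x ∙ y ≈ y ∙ x
  comm x y = begin
    x ∙ y                              ≈⟨ ∙-cong (log-spec x) (log-spec y) ⟩
    pow C g (log x) ∙ pow C g (log y)  ≈⟨ pow-+ g (log x) (log y) ⟨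
    pow C g (log x + log y)            ≡⟨ ≡.cong (pow C g) (ℕ.+-comm (log x) (log y)) ⟩
    pow C g (log y + log x)            ≈⟨ pow-+ g (log y) (log x) ⟩
    pow C g (log y) ∙ pow C g (log x)  ≈⟨ ∙-cong (log-spec y) (log-spec x) ⟨
    y ∙ x                              ∎

  commutativeMonoid : CommutativeMonoid c ℓ
  commutativeMonoid = record { isCommutativeMonoid = record { isMonoid = isMonoid ; comm = comm } }

  pow-distrib-∙ : ∀ x y n → pow C (x ∙ y) n ≈ pow C x n ∙ pow C y n
  pow-distrib-∙ x y n rewrite pow≡× (x ∙ y) n | pow≡× x n | pow≡× y n = ×-distrib-+ x y n
    where open CommutativeMonoidMult commutativeMonoid using (×-distrib-+)

  pow-hom : ∀ k → IsHom C C (λ x → pow C x k)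
  pow-hom k = isHom C C _ (pow-cong k) (λ x y → pow-distrib-∙ x y k)

  -- g has a period d ≤ p; reducing logarithms mod d injects C into Fin d, so d = p.
  pow-generator-p : pow C g p ≈ ε
  pow-generator-p with pow-period order g
  ... | d , 0<d , d≤p , gᵈ≈ε = ≡.subst (λ t → pow C g t ≈ ε) (ℕ.≤-antisym d≤p p≤d) gᵈ≈ε
    where
    instance
      d-nonZero : NonZero d
      d-nonZero = ℕ.>-nonZero 0<d
    f : Fin p → Carrier
    f = proj₁ order
    log-mod : Fin p → Fin d
    log-mod i = fromℕ< (m%n<n (log (f i)) d)
    f≈gˡᵒᵍ : ∀ i → f i ≈ pow C g (toℕ (log-mod i))
    f≈gˡᵒᵍ i = begin
      f i                          ≈⟨ log-spec (f i) ⟩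
      pow C g (log (f i))          ≈⟨ pow-mod g d gᵈ≈ε (log (f i)) ⟩
      pow C g (log (f i) % d)      ≡⟨ ≡.cong (pow C g) (Fin.toℕ-fromℕ< (m%n<n (log (f i)) d)) ⟨
      pow C g (toℕ (log-mod i))    ∎
    log-mod-injective : Injective _≡_ _≡_ log-mod
    log-mod-injective {i} {j} e = proj₁ (proj₂ (proj₂ order)) i j
      (trans (f≈gˡᵒᵍ i) (trans (reflexive (≡.cong (λ k → pow C g (toℕ k)) e)) (sym (f≈gˡᵒᵍ j))))
    p≤d : p ≤ d
    p≤d = Fin.injective⇒≤ log-mod-injective

  pow-p : ∀ x → pow C x p ≈ ε
  pow-p x = begin
    pow C x p                  ≈⟨ pow-cong p (log-spec x) ⟩
    pow C (pow C g (log x)) p  ≈⟨ pow-* g p (log x) ⟨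
    pow C g (p * log x)        ≡⟨ ≡.cong (pow C g) (ℕ.*-comm p (log x)) ⟩
    pow C g (log x * p)        ≈⟨ pow-multiple-ε g p pow-generator-p (log x) ⟩
    ε                          ∎

  residue : ℕ → Fin p
  residue m = fromℕ< (m%n<n m p)

  pow-residue : ∀ x m → pow C x m ≈ pow C x (toℕ (residue m))
  pow-residue x m = begin
    pow C x m                   ≈⟨ pow-mod x p (pow-p x) m ⟩
    pow C x (m % p)             ≡⟨ ≡.cong (pow C x) (Fin.toℕ-fromℕ< (m%n<n m p)) ⟨
    pow C x (toℕ (residue m))   ∎

  pow-injective : ∀ x → ¬ x ≈ ε → ∀ (i j : Fin p) → pow C x (toℕ i) ≈ pow C x (toℕ j) → i ≡ j
  pow-injective x = pow-prime-injective p-prime x (pow-p x)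

  generated-by : ∀ x → ¬ x ≈ ε → ∀ y → ∃ λ m → y ≈ pow C x m
  generated-by x x≉ε = powers-cover order x (pow-injective x x≉ε)

  _≟_ : Decidable _≈_
  _≟_ = Order⇒decidable order

  nontrivial : ∃ λ x → ¬ x ≈ ε
  nontrivial with x , _ , x≉ε ← nontrivial-element _≟_ (ℕ.nonTrivial⇒n>1 p) order = x , x≉ε

module CentralExtension {c ℓ p} (p-prime : Prime p) (C G H : Group c ℓ)
    (C-order : Order C p) (C-cyclic : IsCyclic C) (G-finite : Finite G)
    (ι : Group.Carrier C → Group.Carrier G)
    (ι-mono : GroupMorphisms.IsGroupMonomorphism (Group.rawGroup C) (Group.rawGroup G) ι)
    (κ : Group.Carrier G → Group.Carrier H) (κ-hom : IsHom G H κ)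
    (κ-onto : ∀ y → ∃ λ x → Group._≈_ H (κ x) y)
    (κι≈ε : ∀ x → Group._≈_ H (κ (ι x)) (Group.ε H))
    (ker-κ⊆im-ι : ∀ g → Group._≈_ H (κ g) (Group.ε H) → ∃ λ x → Group._≈_ G (ι x) g)
    (ι-central : ∀ x → Central G (ι x)) where
  private
    module C = Group C
    module H = Group H
    module G = Group G
    module G′ = GroupLemmas G
    module C′ = GroupLemmas C
    module Ι = GroupMorphisms.IsGroupMonomorphism ι-mono
    module Κ = GroupMorphisms.IsGroupHomomorphism κ-hom
  open CyclicOfPrimeOrder C p-prime C-order C-cyclic

  G̃ : Group c ℓ
  G̃ = C ⊗ G

  private
    module G̃ = Group G̃
    module G̃′ = GroupLemmas G̃

  D : Subgroup G̃
  D = DSubgroup {C = C} {G = G} {H = H} κ κ-hom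

  ι⁻¹ : ∀ b → κ b H.≈ H.ε → C.Carrier
  ι⁻¹ b κb≈ε = proj₁ (ker-κ⊆im-ι b κb≈ε)

  ι∘ι⁻¹ : ∀ b κb≈ε → ι (ι⁻¹ b κb≈ε) G.≈ b
  ι∘ι⁻¹ b κb≈ε = proj₂ (ker-κ⊆im-ι b κb≈ε)

  ι-ε⇒ε : ∀ {x} → ι x G.≈ G.ε → x C.≈ C.ε
  ι-ε⇒ε ιx≈ε = Ι.injective (G.trans ιx≈ε (G.sym Ι.ε-homo))

  fiber-embedding : G̃.Carrier → G.Carrier × G.Carrier
  fiber-embedding (a , b) = b , ι a G.∙ b

  fiber-embedding-hom : IsHom G̃ (G ⊗ G) fiber-embedding
  fiber-embedding-hom = isHom G̃ (G ⊗ G) fiber-embedding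
    (λ (a≈a′ , b≈b′) → b≈b′ , G.∙-cong (Ι.⟦⟧-cong a≈a′) b≈b′)
    λ (a , b) (a′ , b′) → G.refl , G.trans (G.∙-congʳ (Ι.∙-homo a a′))
                                            (G′.∙-interchange (ι a) (ι a′) b b′ (ι-central a′ b))

  fiber-embedding-injective : Injective G̃._≈_ (Group._≈_ (G ⊗ G)) fiber-embedding
  fiber-embedding-injective {a , b} {a′ , b′} (b≈b′ , ιa∙b≈ιa′∙b′) =
    Ι.injective (G′.∙-cancelʳ b (ι a) (ι a′) (G.trans ιa∙b≈ιa′∙b′ (G.∙-congˡ (G.sym b≈b′)))) , b≈b′

  fiberProduct≅ : Group.rawGroup G̃ ≅ FiberProduct {G₁ = G} {G₂ = G} {H = H} κ κ κ-hom κ-hom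
  fiberProduct≅ = ≅-image {A = G̃} {B = G ⊗ G} fiber-embedding-hom fiber-embedding-injective
    (fiberSubgroup {G₁ = G} {G₂ = G} {H = H} κ κ κ-hom κ-hom)
    (λ (a , b) → H.sym (H.trans (Κ.homo (ι a) b) (H.trans (H.∙-congʳ (κι≈ε a)) (H.identityˡ (κ b)))))
    fiber⊆image
    where
    fiber⊆image : ∀ y → κ (proj₁ y) H.≈ κ (proj₂ y) → ∃ λ x → Group._≈_ (G ⊗ G) (fiber-embedding x) y
    fiber⊆image (g₁ , g₂) κg₁≈κg₂ = (ι⁻¹ _ g₂g₁⁻¹∈ker , g₁) , G.refl ,
      G.trans (G.∙-congʳ (ι∘ι⁻¹ _ g₂g₁⁻¹∈ker)) (G′.//-rightDividesˡ g₁ g₂)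
      where
      g₂g₁⁻¹∈ker : κ (g₂ G.∙ g₁ G.⁻¹) H.≈ H.ε
      g₂g₁⁻¹∈ker = Kernel.≈⇒∈kernel {A = G} {K = H} κ κ-hom (H.sym κg₁≈κg₂)

  D-section : Group.Carrier (C ⊗ C) → G̃.Carrier
  D-section (a , k) = a , ι k

  D-section-hom : IsHom (C ⊗ C) G̃ D-section
  D-section-hom = isHom (C ⊗ C) G̃ D-section (λ (a≈a′ , k≈k′) → a≈a′ , Ι.⟦⟧-cong k≈k′)
    λ (a , k) (a′ , k′) → C.refl , Ι.∙-homo k k′

  D≅C⊗C : subRaw G̃ D ≅ Group.rawGroup (C ⊗ C)
  D≅C⊗C = ≅-preimage {A = C ⊗ C} {B = G̃} D-section-hom (λ (a≈a′ , ιk≈ιk′) → a≈a′ , Ι.injective ιk≈ιk′)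
    D (λ (_ , k) → κι≈ε k)
    (λ (a , b) κb≈ε → a , ι⁻¹ b κb≈ε) (λ (a , b) κb≈ε → C.refl , ι∘ι⁻¹ b κb≈ε)

  D⊆center : _⊆_ G̃ (mem D) (Central G̃)
  D⊆center (a , b) κb≈ε (a′ , b′) = comm a a′ , G′.central-resp (ι∘ι⁻¹ b κb≈ε) (ι-central _) b′

  center⇒central₂ : ∀ x → Central G̃ x → Central G (proj₂ x)
  center⇒central₂ x x-central g = proj₂ (x-central (C.ε , g))

  central₂⇒center : ∀ x → Central G (proj₂ x) → Central G̃ x
  central₂⇒center x x₂-central (a , g) = comm (proj₁ x) a , x₂-central g

  line₀-map : G̃.Carrier → Group.Carrier (C ⊗ H)
  line₀-map (a , b) = a , κ b

  line₀-map-hom : IsHom G̃ (C ⊗ H) line₀-map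
  line₀-map-hom = isHom G̃ (C ⊗ H) line₀-map (λ (a≈a′ , b≈b′) → a≈a′ , Κ.⟦⟧-cong b≈b′)
    λ (a , b) (a′ , b′) → C.refl , Κ.homo b b′

  slope : ℕ → C.Carrier → G.Carrier
  slope k a = ι (pow C a k)

  module Line (k : ℕ) = Graph {C = C} {G = G} (slope k)
    (Composition.isGroupHomomorphism G.trans (pow-hom k) Ι.isGroupHomomorphism) (λ a → ι-central (pow C a k))

  U : Fin (suc p) → Subgroup G̃
  U zero    = Kernel.kernel {A = G̃} {K = C ⊗ H} line₀-map line₀-map-hom
  U (suc k) = Line.graph (toℕ k)

  U⊆D : ∀ i → _⊆_ G̃ (mem (U i)) (mem D)
  U⊆D zero    (a , b) (_ , κb≈ε) = κb≈ε
  U⊆D (suc k) (a , b) ab∈U = H.trans (Κ.⟦⟧-cong (Line.∈graph⇒ (toℕ k) ab∈U)) (κι≈ε _)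

  U-size : ∀ i → HasSize G̃ (mem (U i)) p
  U-size zero    = let f , _ , f-injective , f-onto = C-order in
    (λ i → C.ε , ι (f i)) , (λ i → C.refl , κι≈ε (f i)) ,
    (λ i j (_ , ιfi≈ιfj) → f-injective i j (Ι.injective ιfi≈ιfj)) ,
    λ (a , b) (a≈ε , κb≈ε) → proj₁ (f-onto (ι⁻¹ b κb≈ε) tt) , C.sym a≈ε ,
                             G.trans (Ι.⟦⟧-cong (proj₂ (f-onto _ tt))) (ι∘ι⁻¹ b κb≈ε)
  U-size (suc k) = Line.graph-size (toℕ k) C-order

  private
    G̃-decidable : Decidable G̃._≈_
    G̃-decidable = ×-decidable _≟_ (G′.Order⇒decidable (proj₂ G-finite))
    1<p : 1 < p
    1<p = ℕ.nonTrivial⇒n>1 p {{prime⇒nonTrivial p-prime}}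
    g : C.Carrier
    g = proj₁ nontrivial
    g≉ε : ¬ g C.≈ C.ε
    g≉ε = proj₂ nontrivial

  U₀⊈U : ∀ k → ¬ _⊆_ G̃ (mem (U zero)) (mem (U (suc k)))
  U₀⊈U k U₀⊆U = g≉ε (ι-ε⇒ε (G.trans ιg≈slope (G.trans (Ι.⟦⟧-cong (C′.pow-ε (toℕ k))) Ι.ε-homo)))
    where
    ιg≈slope : ι g G.≈ slope (toℕ k) C.ε
    ιg≈slope = Line.∈graph⇒ (toℕ k) (U₀⊆U (C.ε , ι g) (C.refl , κι≈ε g))

  U-injective : ∀ i j → _≐_ G̃ (U i) (U j) → i ≡ j
  U-injective zero    zero     _         = ≡.refl
  U-injective zero    (suc k)  (U₀⊆U , _) = ⊥-elim (U₀⊈U k U₀⊆U)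
  U-injective (suc k) zero     (_ , U₀⊆U) = ⊥-elim (U₀⊈U k U₀⊆U)
  U-injective (suc k) (suc k′) (U⊆U′ , _) = ≡.cong suc (pow-injective g g≉ε k k′ (Ι.injective gᵏ≈gᵏ′))
    where
    gᵏ≈gᵏ′ : ι (pow C g (toℕ k)) G.≈ ι (pow C g (toℕ k′))
    gᵏ≈gᵏ′ = Line.∈graph⇒ (toℕ k′) (U⊆U′ _ (Line.∈graph⇐ (toℕ k) G.refl))

  U-normal : ∀ i → IsNormal G̃ (U i)
  U-normal i = G̃′.central⇒normal (U i) (λ x x∈U → D⊆center x (U⊆D i x x∈U))

  quotient-U₀≅ : quotRaw G̃ (U zero) ≅ Group.rawGroup (C ⊗ H)
  quotient-U₀≅ = Kernel.quotient-kernel≅ {A = G̃} {K = C ⊗ H} line₀-map line₀-map-hom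
    λ (a , h) → (a , proj₁ (κ-onto h)) , C.refl , proj₂ (κ-onto h)

  quotient-U≅ : ∀ i → i ≢ zero → quotRaw G̃ (U i) ≅ Group.rawGroup G
  quotient-U≅ zero    0≢0 = ⊥-elim (0≢0 ≡.refl)
  quotient-U≅ (suc k) _   = Line.quotient-graph≅ (toℕ k)

  pow-∈D : ∀ {a b k} → b G.≈ ι k → ∀ n → pow G̃ (a , b) n G̃.≈ (pow C a n , ι (pow C k n))
  pow-∈D {a} {b} {k} b≈ιk n = G̃.trans (pow-⊗ C G a b n)
    (C.refl , G.trans (G′.pow-cong n b≈ιk) (G.sym (hom-pow C G Ι.isGroupHomomorphism k n)))

  U₀⊆powers : ∀ {a b} → κ b H.≈ H.ε → a C.≈ C.ε → ¬ (a , b) G̃.≈ G̃.ε →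
              ∀ u → mem (U zero) u → ∃ λ n → pow G̃ (a , b) n G̃.≈ u
  U₀⊆powers {a} {b} κb≈ε a≈ε v≉ε (a′ , b′) (a′≈ε , κb′≈ε) =
    n , G̃.trans (pow-∈D (G.sym (ι∘ι⁻¹ b κb≈ε)) n)
          ( C.trans (C′.pow-cong n a≈ε) (C.trans (C′.pow-ε n) (C.sym a′≈ε))
          , G.trans (Ι.⟦⟧-cong (C.sym k′≈kⁿ)) (ι∘ι⁻¹ b′ κb′≈ε))
    where
    k : C.Carrier
    k = ι⁻¹ b κb≈ε
    k≉ε : ¬ k C.≈ C.ε
    k≉ε k≈ε = v≉ε (a≈ε , G.trans (G.sym (ι∘ι⁻¹ b κb≈ε)) (G.trans (Ι.⟦⟧-cong k≈ε) Ι.ε-homo))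
    n : ℕ
    n = proj₁ (generated-by k k≉ε (ι⁻¹ b′ κb′≈ε))
    k′≈kⁿ : ι⁻¹ b′ κb′≈ε C.≈ pow C k n
    k′≈kⁿ = proj₂ (generated-by k k≉ε (ι⁻¹ b′ κb′≈ε))

  U-slope⊆powers : ∀ {a b m} → b G.≈ ι (pow C a m) → ¬ a C.≈ C.ε →
                   ∀ u → mem (U (suc (residue m))) u → ∃ λ n → pow G̃ (a , b) n G̃.≈ u
  U-slope⊆powers {a} {b} {m} b≈ιaᵐ a≉ε (a′ , b′) u∈U =
    n , G̃.trans (pow-∈D b≈ιaᵐ n)
          (C.sym a′≈aⁿ , G.trans (Ι.⟦⟧-cong aᵐⁿ≈a′ᵗ) (G.sym (Line.∈graph⇒ (toℕ (residue m)) u∈U)))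
    where
    open SetoidReasoning C.setoid
    n : ℕ
    n = proj₁ (generated-by a a≉ε a′)
    a′≈aⁿ : a′ C.≈ pow C a n
    a′≈aⁿ = proj₂ (generated-by a a≉ε a′)
    aᵐⁿ≈a′ᵗ : pow C (pow C a m) n C.≈ pow C a′ (toℕ (residue m))
    aᵐⁿ≈a′ᵗ = begin
      pow C (pow C a m) n          ≈⟨ C′.pow-* a n m ⟨
      pow C a (n * m)              ≡⟨ ≡.cong (pow C a) (ℕ.*-comm n m) ⟩
      pow C a (m * n)              ≈⟨ C′.pow-* a m n ⟩
      pow C (pow C a n) m          ≈⟨ C′.pow-cong m a′≈aⁿ ⟨
      pow C a′ m                   ≈⟨ pow-residue a′ m ⟩
      pow C a′ (toℕ (residue m))   ∎

  U-classify : ∀ V → _⊆_ G̃ (mem V) (mem D) → HasSize G̃ (mem V) p → ∃ λ i → _≐_ G̃ V (U i)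
  U-classify V V⊆D V-size
    with (a , b) , v∈V , v≉ε ← G̃′.nontrivial-element G̃-decidable 1<p V-size
    with a ≟ C.ε
  ... | yes a≈ε = zero , G̃′.≐-by-powers (U zero) V (U-size zero) V-size v∈V
                           (U₀⊆powers (V⊆D _ v∈V) a≈ε v≉ε)
  ... | no a≉ε  = suc (residue m) , G̃′.≐-by-powers (U (suc (residue m))) V (U-size (suc (residue m))) V-size v∈V
                                      (U-slope⊆powers b≈ιaᵐ a≉ε)
    where
    κb≈ε : κ b H.≈ H.ε
    κb≈ε = V⊆D _ v∈V
    m : ℕ
    m = proj₁ (generated-by a a≉ε (ι⁻¹ b κb≈ε))
    b≈ιaᵐ : b G.≈ ι (pow C a m)
    b≈ιaᵐ = G.trans (G.sym (ι∘ι⁻¹ b κb≈ε)) (Ι.⟦⟧-cong (proj₂ (generated-by a a≉ε (ι⁻¹ b κb≈ε))))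

theorem4p7 : {c ℓ : Level} (p : ℕ) → Prime p
  → (C G H : Group c ℓ)
  → Order C p → IsCyclic C → Finite G → Finite H
  → (ι : Group.Carrier C → Group.Carrier G)
  → GroupMorphisms.IsGroupMonomorphism (Group.rawGroup C) (Group.rawGroup G) ι
  → (κ : Group.Carrier G → Group.Carrier H) → (hκ : IsHom G H κ)
  → (∀ y → ∃ λ x → Group._≈_ H (κ x) y)
  → (∀ x → Group._≈_ H (κ (ι x)) (Group.ε H))
  → (∀ g → Group._≈_ H (κ g) (Group.ε H) → ∃ λ x → Group._≈_ G (ι x) g)
  → (∀ x → Central G (ι x))
  → let G̃ = C ⊗ G
        D = DSubgroup {C = C} {G = G} {H = H} κ hκ
    in (Group.rawGroup G̃ ≅ FiberProduct {G₁ = G} {G₂ = G} {H = H} κ κ hκ hκ)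
     × (subRaw G̃ D ≅ Group.rawGroup (C ⊗ C))
     × (_⊆_ G̃ (mem D) (Central G̃))
     × (∀ x → Central G̃ x → Central G (proj₂ x))
     × (∀ x → Central G (proj₂ x) → Central G̃ x)
     × Σ (Fin (suc p) → Subgroup G̃) λ U →
         (∀ i → _⊆_ G̃ (mem (U i)) (mem D))
       × (∀ i → HasSize G̃ (mem (U i)) p)
       × (∀ i j → _≐_ G̃ (U i) (U j) → i ≡ j)
       × (∀ V → _⊆_ G̃ (mem V) (mem D) → HasSize G̃ (mem V) p → ∃ λ i → _≐_ G̃ V (U i))
       × (∀ i → IsNormal G̃ (U i))
       × ∃ λ i₀ → (quotRaw G̃ (U i₀) ≅ Group.rawGroup (C ⊗ H))
                × (∀ i → i ≢ i₀ → quotRaw G̃ (U i) ≅ Group.rawGroup G)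
theorem4p7 p p-prime C G H C-order C-cyclic G-finite _ ι ι-mono κ κ-hom κ-onto κι≈ε ker-κ⊆im-ι ι-central =
    fiberProduct≅ , D≅C⊗C , D⊆center , center⇒central₂ , central₂⇒center
  , U , U⊆D , U-size , U-injective , U-classify , U-normal , zero , quotient-U₀≅ , quotient-U≅
  where
  open CentralExtension p-prime C G H C-order C-cyclic G-finite ι ι-mono κ κ-hom κ-onto κι≈ε ker-κ⊆im-ι ι-central
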